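{- Let $p$ be a prime and $(r,e,d)\in\mathscr{U}(p)$ with $r\mid p-1$; write $rs=p-1$. Then, in $\mathbb{F}_p$, \[ \det M_d((x^r-1)^e)=(-1)^{d(d-1)/2+(r-1)g/2}\binom{e}{s}\binom{e}{2s}\cdots\binom{e}{ds}, \] where $g=\left\{red-\frac{d(d+1)}{2}(p-1)\right\}\Big/\frac{r(r-1)}{2}$. In particular $\det M_d((x^r-1)^e)\ne0$.
   Context: For a polynomial $F(x)\in\mathbb{F}_p[x]$ and integers $e\ge0$, $0\le d\le p$, write $F(x)^e=\sum_{i\ge0}c_ix^i$ and let $M_d(F(x)^e)$ be the $d\times d$ matrix over $\mathbb{F}_p$ with $(i,j)$ entry $c_{ip+j-d-1}$ ($1\le i,j\le d$). For integers $(r,e,d)$ put $g=\left\{red-\frac{d(d+1)}{2}(p-1)\right\}\Big/\frac{r(r-1)}{2}$. $\mathscr{U}(p)$ is the set of $(r,e,d)\in\mathbb{Z}^3$ with $r\ge2$, $e\ge1$, $1\le d\le p$, $d(p-1)\le re\le r(p-1)$, $g>0$, and $g\in2\mathbb{Z}$ when $p\ne2$, $g\in\mathbb{Z}$ when $p=2$. -}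

module Defs where

open import Data.Nat as ℕ using (ℕ; zero; suc; _≤_; _<_)
open import Data.Nat.Divisibility using (_∣_)
open import Data.Nat.Combinatorics using (_C_)
open import Data.Integer as ℤ using (ℤ; +_; -_; _-_; _+_; _*_)
open import Data.Integer.Divisibility as ℤD using ()
open import Data.Fin using (Fin; toℕ; punchIn) renaming (zero to fz; suc to fs)
open import Data.List using (List; []; _∷_; map; replicate; _++_)
open import Relation.Binary.PropositionalEquality using (_≡_; _≢_)
open import Data.Product using (Σ; _×_)

-- Polynomials with integer coefficients, as coefficient lists
-- (ascending degree).  Everything is reduced mod p only at the end:
-- reduction ℤ → 𝔽_p is a ring homomorphism, so coefficients of
-- F(x)^e over 𝔽_p are the reductions of the integer coefficients.

Poly : Set
Poly = List ℤ

infixl 6 _+ₚ_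
infixl 7 _*ₚ_
infixr 8 _^ₚ_

_+ₚ_ : Poly → Poly → Poly
[] +ₚ q = q
(a ∷ p) +ₚ [] = a ∷ p
(a ∷ p) +ₚ (b ∷ q) = (a + b) ∷ (p +ₚ q)

_*ₚ_ : Poly → Poly → Poly
[] *ₚ q = []
(a ∷ p) *ₚ q = map (a *_) q +ₚ (+ 0 ∷ (p *ₚ q))

_^ₚ_ : Poly → ℕ → Poly
p ^ₚ zero = + 1 ∷ []
p ^ₚ suc n = p *ₚ (p ^ₚ n)

constP : ℤ → Poly
constP c = c ∷ []

xPow : ℕ → Poly
xPow r = replicate r (+ 0) ++ (+ 1 ∷ [])

coeff : Poly → ℕ → ℤ
coeff [] k = + 0
coeff (a ∷ p) zero = a
coeff (a ∷ p) (suc k) = coeff p k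

sumFin : (n : ℕ) → (Fin n → ℤ) → ℤ
sumFin zero f = + 0
sumFin (suc n) f = f fz + sumFin n (λ i → f (fs i))

sign : ℕ → ℤ
sign n = (- + 1) ℤ.^ n

det : (n : ℕ) → (Fin n → Fin n → ℤ) → ℤ
det zero A = + 1
det (suc n) A =
  sumFin (suc n) (λ j → sign (toℕ j) * A fz j * det n (λ k l → A (fs k) (punchIn j l)))

-- M_d(F^e): d×d matrix, (i,j) entry (1-based) c_{ip+j-d-1}.
-- Here i, j : Fin d are 0-based, so the index is (i+1)p + (j+1) - d - 1,
-- which is ≥ p - d ≥ 0 since d ≤ p (so truncated subtraction is exact).

M : (p d : ℕ) → Poly → Fin d → Fin d → ℤ
M p d F i j = coeff F (suc (toℕ i) ℕ.* p ℕ.+ suc (toℕ j) ℕ.∸ suc d)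

-- congruence modulo p in ℤ, i.e. equality in 𝔽_p
infix 4 _≡_[mod_]
_≡_[mod_] : ℤ → ℤ → ℕ → Set
a ≡ b [mod p ] = (+ p) ℤD.∣ (a - b)

-- Since r ≥ 2, r(r-1)/2 > 0, so g is determined by
-- g · r(r-1) = 2red - d(d+1)(p-1).

record InU (p r e d g : ℕ) : Set where
  field
    r≥2   : 2 ≤ r
    e≥1   : 1 ≤ e
    d≥1   : 1 ≤ d
    d≤p   : d ≤ p
    lower : d ℕ.* (p ℕ.∸ 1) ≤ r ℕ.* e
    upper : r ℕ.* e ≤ r ℕ.* (p ℕ.∸ 1)
    g>0   : 0 < g
    g-def : g ℕ.* (r ℕ.* (r ℕ.∸ 1)) ℕ.+ d ℕ.* (d ℕ.+ 1) ℕ.* (p ℕ.∸ 1)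
              ≡ 2 ℕ.* (r ℕ.* e ℕ.* d)
    g-even : p ≢ 2 → 2 ∣ g

binomProd : (e s d : ℕ) → ℤ
binomProd e s zero = + 1
binomProd e s (suc d) = binomProd e s d * + (e C (suc d ℕ.* s))

{-# OPTIONS --safe #-}
module Submission where

-- The coefficient of x^(qr+t) in (xʳ − 1)ᵉ is (−1)^(e−q) C(e,q) when t = 0
-- and vanishes when 0 < t < r.  With 0-based i, j the (i,j) entry of M_d sits at index
-- (i+1)s·r + (i+j+1−d), and |i+j+1−d| < d ≤ r because ds ≤ e ≤ rs; so M_d is antidiagonal with
-- entries (−1)^(e−(i+1)s) C(e,(i+1)s), and its determinant is (−1)^C(d,2) times their product.
-- The exponents add up to de − s·d(d+1)/2 = (r−1)g/2 by the defining equation of g.  All of this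
-- holds over ℤ; the determinant is nonzero mod p because e < p, so p divides no C(e,k).

open import Defs

open import Algebra.Bundles using (Monoid)
open import Data.Empty using (⊥-elim)
open import Data.Fin as Fin using (Fin; toℕ; fromℕ; inject₁; opposite; punchIn)
import Data.Fin.Properties as FinP
open import Data.Integer as ℤ using (ℤ; +_; -_; _-_; _*_; _+_)
import Data.Integer.Properties as ℤP
open import Data.Integer.Tactic.RingSolver using (solve-∀)
open import Data.List using ([]; _∷_; map)
open import Data.Nat as ℕ using (ℕ; zero; suc; _<_; _≤_; z≤n; s≤s; _∸_; _!)
import Data.Nat.Properties as ℕP
import Data.Nat.Tactic.RingSolver as ℕ-Solver
open import Data.Nat.Combinatorics using (_C_; nCk+nC[k+1]≡[n+1]C[k+1]; nC1≡n; nCk≡nPk/k!; k![n∸k]!∣n!)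
open import Data.Nat.Combinatorics.Specification using (k>n⇒nCk≡0; nCk≡n!/k![n-k]!)
open import Data.Nat.Divisibility using (_∣_; _∣0; ∣1⇒≡1; ∣⇒≤; ∣m⇒∣m*n)
open import Data.Nat.DivMod using (_/_; m*n/n≡m; m/n*n≡m)
open import Data.Nat.Primality using (Prime; prime⇒nonTrivial; euclidsLemma)
open import Data.Product using (_×_; _,_)
open import Data.Sum using (inj₁; inj₂)
open import Function using (_∘_)
open import Relation.Binary.Definitions using (tri<; tri≈; tri>)
open import Relation.Binary.PropositionalEquality
open import Relation.Nullary using (¬_; yes; no)
open import Algebra.Properties.CommutativeMonoid.Sum ℤP.*-1-commutativeMonoid
  using () renaming (sum to ∏; sum-cong-≗ to ∏-cong; ∑-distrib-+ to ∏-distrib-*)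
open import Algebra.Properties.Monoid.Sum ℕP.+-0-monoid using () renaming (sum to ∑)

coeff-+ₚ : ∀ p q k → coeff (p +ₚ q) k ≡ coeff p k + coeff q k
coeff-+ₚ []      q       k       = sym (ℤP.+-identityˡ _)
coeff-+ₚ (a ∷ p) []      k       = sym (ℤP.+-identityʳ _)
coeff-+ₚ (a ∷ p) (b ∷ q) zero    = refl
coeff-+ₚ (a ∷ p) (b ∷ q) (suc k) = coeff-+ₚ p q k

coeff-map-* : ∀ a q k → coeff (map (a *_) q) k ≡ a * coeff q k
coeff-map-* a []      k       = sym (ℤP.*-zeroʳ a)
coeff-map-* a (b ∷ q) zero    = refl
coeff-map-* a (b ∷ q) (suc k) = coeff-map-* a q k

coeff-∷-*ₚ : ∀ a p q k → coeff ((a ∷ p) *ₚ q) k ≡ a * coeff q k + coeff (+ 0 ∷ (p *ₚ q)) k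
coeff-∷-*ₚ a p q k = trans (coeff-+ₚ (map (a *_) q) _ k) (cong (_+ _) (coeff-map-* a q k))

coeff-*ₚ-distribʳ-+ₚ : ∀ p q s k → coeff ((p +ₚ q) *ₚ s) k ≡ coeff (p *ₚ s) k + coeff (q *ₚ s) k
coeff-*ₚ-distribʳ-+ₚ []      q       s k = sym (ℤP.+-identityˡ _)
coeff-*ₚ-distribʳ-+ₚ (a ∷ p) []      s k = sym (ℤP.+-identityʳ _)
coeff-*ₚ-distribʳ-+ₚ (a ∷ p) (b ∷ q) s k = begin
  coeff (((a + b) ∷ (p +ₚ q)) *ₚ s) k
    ≡⟨ coeff-∷-*ₚ (a + b) (p +ₚ q) s k ⟩
  (a + b) * coeff s k + coeff (+ 0 ∷ ((p +ₚ q) *ₚ s)) k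
    ≡⟨ cong (_+_ ((a + b) * coeff s k)) (shifted k) ⟩
  (a + b) * coeff s k + (coeff (+ 0 ∷ (p *ₚ s)) k + coeff (+ 0 ∷ (q *ₚ s)) k)
    ≡⟨ regroup a b (coeff s k) _ _ ⟩
  (a * coeff s k + coeff (+ 0 ∷ (p *ₚ s)) k) + (b * coeff s k + coeff (+ 0 ∷ (q *ₚ s)) k)
    ≡⟨ sym (cong₂ _+_ (coeff-∷-*ₚ a p s k) (coeff-∷-*ₚ b q s k)) ⟩
  coeff ((a ∷ p) *ₚ s) k + coeff ((b ∷ q) *ₚ s) k ∎
  where
  open ≡-Reasoning
  regroup : ∀ a b x y z → (a + b) * x + (y + z) ≡ (a * x + y) + (b * x + z)
  regroup = solve-∀
  shifted : ∀ k → coeff (+ 0 ∷ ((p +ₚ q) *ₚ s)) k ≡ coeff (+ 0 ∷ (p *ₚ s)) k + coeff (+ 0 ∷ (q *ₚ s)) k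
  shifted zero    = refl
  shifted (suc k) = coeff-*ₚ-distribʳ-+ₚ p q s k

coeff-constP-*ₚ : ∀ c q k → coeff (constP c *ₚ q) k ≡ c * coeff q k
coeff-constP-*ₚ c q zero    = trans (coeff-∷-*ₚ c [] q 0) (ℤP.+-identityʳ _)
coeff-constP-*ₚ c q (suc k) = trans (coeff-∷-*ₚ c [] q (suc k)) (ℤP.+-identityʳ _)

coeff-x*ₚ : ∀ p q k → coeff ((+ 0 ∷ p) *ₚ q) (suc k) ≡ coeff (p *ₚ q) k
coeff-x*ₚ p q k = trans (coeff-∷-*ₚ (+ 0) p q (suc k)) (ℤP.+-identityˡ _)

coeff-xPow-*ₚ-< : ∀ m q k → k < m → coeff (xPow m *ₚ q) k ≡ + 0
coeff-xPow-*ₚ-< (suc m) q zero    _         = trans (coeff-∷-*ₚ (+ 0) (xPow m) q 0) (ℤP.+-identityʳ _)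
coeff-xPow-*ₚ-< (suc m) q (suc k) (s≤s k<m) = trans (coeff-x*ₚ (xPow m) q k) (coeff-xPow-*ₚ-< m q k k<m)

coeff-xPow-*ₚ-+ : ∀ m q k → coeff (xPow m *ₚ q) (m ℕ.+ k) ≡ coeff q k
coeff-xPow-*ₚ-+ zero    q k = trans (coeff-constP-*ₚ (+ 1) q k) (ℤP.*-identityˡ _)
coeff-xPow-*ₚ-+ (suc m) q k = trans (coeff-x*ₚ (xPow m) q (m ℕ.+ k)) (coeff-xPow-*ₚ-+ m q k)

xPow-1 : ℕ → Poly
xPow-1 r = xPow r +ₚ constP (- + 1)

coeff-xPow-1-*ₚ : ∀ r q n → coeff (xPow-1 r *ₚ q) n ≡ coeff (xPow r *ₚ q) n - coeff q n
coeff-xPow-1-*ₚ r q n = trans (coeff-*ₚ-distribʳ-+ₚ (xPow r) (constP (- + 1)) q n)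
  (cong (_+_ (coeff (xPow r *ₚ q) n)) (trans (coeff-constP-*ₚ (- + 1) q n) (ℤP.-1*i≡-i _)))

sign-suc : ∀ n → sign (suc n) ≡ - sign n
sign-suc n = ℤP.-1*i≡-i (sign n)

signed-pascal : ∀ e q →
  sign (e ∸ q) * + (e C q) - sign (e ∸ suc q) * + (e C suc q) ≡ sign (e ∸ q) * + (suc e C suc q)
signed-pascal e q with q ℕ.<? e
... | yes q<e = begin
  sign (e ∸ q) * + (e C q) - σ * + (e C suc q)
    ≡⟨ cong (λ τ → τ * + (e C q) - σ * + (e C suc q)) sign[e∸q]≡-σ ⟩
  - σ * + (e C q) - σ * + (e C suc q)
    ≡⟨ factor σ (+ (e C q)) (+ (e C suc q)) ⟩
  - σ * (+ (e C q) + + (e C suc q))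
    ≡⟨ cong₂ (λ τ n → τ * + n) (sym sign[e∸q]≡-σ) (nCk+nC[k+1]≡[n+1]C[k+1] e q) ⟩
  sign (e ∸ q) * + (suc e C suc q) ∎
  where
  open ≡-Reasoning
  σ = sign (e ∸ suc q)
  sign[e∸q]≡-σ : sign (e ∸ q) ≡ - σ
  sign[e∸q]≡-σ = trans (cong sign (ℕP.+-∸-assoc 1 q<e)) (sign-suc (e ∸ suc q))
  factor : ∀ σ x y → - σ * x - σ * y ≡ - σ * (x + y)
  factor = solve-∀
... | no q≮e = begin
  sign (e ∸ q) * + (e C q) - sign (e ∸ suc q) * + (e C suc q)
    ≡⟨ cong (λ n → sign (e ∸ q) * + (e C q) - sign (e ∸ suc q) * + n) e[C]1+q≡0 ⟩
  sign (e ∸ q) * + (e C q) - sign (e ∸ suc q) * + 0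
    ≡⟨ drop (sign (e ∸ q)) (sign (e ∸ suc q)) (+ (e C q)) ⟩
  sign (e ∸ q) * + (e C q ℕ.+ 0)
    ≡⟨ cong (λ n → sign (e ∸ q) * + (e C q ℕ.+ n)) (sym e[C]1+q≡0) ⟩
  sign (e ∸ q) * + (e C q ℕ.+ e C suc q)
    ≡⟨ cong (λ n → sign (e ∸ q) * + n) (nCk+nC[k+1]≡[n+1]C[k+1] e q) ⟩
  sign (e ∸ q) * + (suc e C suc q) ∎
  where
  open ≡-Reasoning
  e[C]1+q≡0 : e C suc q ≡ 0
  e[C]1+q≡0 = k>n⇒nCk≡0 (s≤s (ℕP.≮⇒≥ q≮e))
  drop : ∀ σ τ x → σ * x - τ * + 0 ≡ σ * (x + + 0)
  drop = solve-∀

[1+n]C2≡n+nC2 : ∀ n → suc n C 2 ≡ n ℕ.+ n C 2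
[1+n]C2≡n+nC2 n = trans (sym (nCk+nC[k+1]≡[n+1]C[k+1] n 1)) (cong (ℕ._+ n C 2) (nC1≡n n))

nC2≡n[n∸1]/2 : ∀ n → n C 2 ≡ n ℕ.* (n ∸ 1) / 2
nC2≡n[n∸1]/2 zero          = refl
nC2≡n[n∸1]/2 (suc zero)    = refl
nC2≡n[n∸1]/2 (suc (suc n)) =
  trans (nCk≡nPk/k! {k = 2} {n = suc (suc n)} (s≤s (s≤s z≤n))) (cong (_/ 2) (swap (suc n) (suc (suc n))))
  where
  swap : ∀ m n → m ℕ.* (n ℕ.* 1) ≡ n ℕ.* m
  swap = ℕ-Solver.solve-∀

coeff-xPow-1^[q*r+t]≡0 : ∀ {r t} e q → 0 < t → t < r → coeff (xPow-1 r ^ₚ e) (q ℕ.* r ℕ.+ t) ≡ + 0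
coeff-xPow-1^[q*r+t]≡0 {r} {suc t} zero q _ _ = cong (coeff (+ 1 ∷ [])) (ℕP.+-suc (q ℕ.* r) t)
coeff-xPow-1^[q*r+t]≡0 {r} {t} (suc e) zero 0<t t<r = begin
  coeff (xPow-1 r *ₚ xPow-1 r ^ₚ e) t                   ≡⟨ coeff-xPow-1-*ₚ r _ t ⟩
  coeff (xPow r *ₚ xPow-1 r ^ₚ e) t - coeff (xPow-1 r ^ₚ e) t
    ≡⟨ cong₂ _-_ (coeff-xPow-*ₚ-< r _ t t<r) (coeff-xPow-1^[q*r+t]≡0 e 0 0<t t<r) ⟩
  + 0 ∎
  where open ≡-Reasoning
coeff-xPow-1^[q*r+t]≡0 {r} {t} (suc e) (suc q) 0<t t<r = begin
  coeff (xPow-1 r *ₚ xPow-1 r ^ₚ e) (r ℕ.+ q ℕ.* r ℕ.+ t)  ≡⟨ coeff-xPow-1-*ₚ r _ _ ⟩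
  coeff (xPow r *ₚ xPow-1 r ^ₚ e) (r ℕ.+ q ℕ.* r ℕ.+ t) - coeff (xPow-1 r ^ₚ e) (suc q ℕ.* r ℕ.+ t)
    ≡⟨ cong₂ _-_ (trans (cong (coeff (xPow r *ₚ xPow-1 r ^ₚ e)) (ℕP.+-assoc r (q ℕ.* r) t))
                        (coeff-xPow-*ₚ-+ r (xPow-1 r ^ₚ e) (q ℕ.* r ℕ.+ t)))
                 (coeff-xPow-1^[q*r+t]≡0 e (suc q) 0<t t<r) ⟩
  coeff (xPow-1 r ^ₚ e) (q ℕ.* r ℕ.+ t) - + 0
    ≡⟨ cong (_- + 0) (coeff-xPow-1^[q*r+t]≡0 e q 0<t t<r) ⟩
  + 0 ∎
  where open ≡-Reasoning

coeff-xPow-1^[q*r∸t]≡0 : ∀ {r t} e q → 0 < q → 0 < t → t < r → coeff (xPow-1 r ^ₚ e) (q ℕ.* r ∸ t) ≡ + 0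
coeff-xPow-1^[q*r∸t]≡0 {r} {t} e (suc q) _ 0<t t<r = begin
  coeff (xPow-1 r ^ₚ e) (r ℕ.+ q ℕ.* r ∸ t)     ≡⟨ cong (coeff (xPow-1 r ^ₚ e)) index ⟩
  coeff (xPow-1 r ^ₚ e) (q ℕ.* r ℕ.+ (r ∸ t))  ≡⟨ coeff-xPow-1^[q*r+t]≡0 e q (ℕP.m<n⇒0<n∸m t<r) r∸t<r ⟩
  + 0 ∎
  where
  open ≡-Reasoning
  index : r ℕ.+ q ℕ.* r ∸ t ≡ q ℕ.* r ℕ.+ (r ∸ t)
  index = trans (ℕP.+-∸-comm (q ℕ.* r) (ℕP.<⇒≤ t<r)) (ℕP.+-comm (r ∸ t) (q ℕ.* r))
  r∸t<r : r ∸ t < r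
  r∸t<r = ℕP.∸-monoʳ-< 0<t (ℕP.<⇒≤ t<r)

coeff-xPow-1^[q*r] : ∀ {r} e q → 0 < r → coeff (xPow-1 r ^ₚ e) (q ℕ.* r) ≡ sign (e ∸ q) * + (e C q)
coeff-xPow-1^[q*r] zero    zero    _   = refl
coeff-xPow-1^[q*r] zero    (suc q) (s≤s _) = refl
coeff-xPow-1^[q*r] {r} (suc e) zero 0<r = begin
  coeff (xPow-1 r *ₚ xPow-1 r ^ₚ e) 0                   ≡⟨ coeff-xPow-1-*ₚ r _ 0 ⟩
  coeff (xPow r *ₚ xPow-1 r ^ₚ e) 0 - coeff (xPow-1 r ^ₚ e) 0
    ≡⟨ cong₂ _-_ (coeff-xPow-*ₚ-< r _ 0 0<r) (coeff-xPow-1^[q*r] e 0 0<r) ⟩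
  + 0 - sign e * + 1                                     ≡⟨ negate (sign e) ⟩
  sign (suc e) * + 1 ∎
  where
  open ≡-Reasoning
  negate : ∀ σ → + 0 - σ * + 1 ≡ (- + 1 * σ) * + 1
  negate = solve-∀
coeff-xPow-1^[q*r] {r} (suc e) (suc q) 0<r = begin
  coeff (xPow-1 r *ₚ xPow-1 r ^ₚ e) (r ℕ.+ q ℕ.* r)     ≡⟨ coeff-xPow-1-*ₚ r _ _ ⟩
  coeff (xPow r *ₚ xPow-1 r ^ₚ e) (r ℕ.+ q ℕ.* r) - coeff (xPow-1 r ^ₚ e) (suc q ℕ.* r)
    ≡⟨ cong₂ _-_ (trans (coeff-xPow-*ₚ-+ r _ _) (coeff-xPow-1^[q*r] e q 0<r))
                 (coeff-xPow-1^[q*r] e (suc q) 0<r) ⟩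
  sign (e ∸ q) * + (e C q) - sign (e ∸ suc q) * + (e C suc q)  ≡⟨ signed-pascal e q ⟩
  sign (e ∸ q) * + (suc e C suc q) ∎
  where open ≡-Reasoning

module _ {c ℓ} (monoid : Monoid c ℓ) where
  open Monoid monoid using (Carrier; _≈_; _∙_; ∙-cong; reflexive) renaming (trans to ≈-trans)
  open import Algebra.Properties.Monoid.Sum monoid using (sum; sum-init-last; sum-cong-≗)

  sum-toℕ-last : ∀ n (f : ℕ → Carrier) → sum {suc n} (f ∘ toℕ) ≈ sum {n} (f ∘ toℕ) ∙ f n
  sum-toℕ-last n f = ≈-trans (sum-init-last (f ∘ toℕ))
    (∙-cong (reflexive (sum-cong-≗ {n} (cong f ∘ FinP.toℕ-inject₁)))
            (reflexive (cong f (FinP.toℕ-fromℕ n))))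

sign-∑ : ∀ n (h : Fin n → ℕ) → sign (∑ h) ≡ ∏ (sign ∘ h)
sign-∑ zero    h = refl
sign-∑ (suc n) h = trans (ℤP.^-distribˡ-+-* (- + 1) (h Fin.zero) (∑ (h ∘ Fin.suc)))
                         (cong (sign (h Fin.zero) *_) (sign-∑ n (h ∘ Fin.suc)))

binomProd≡∏ : ∀ e s d → binomProd e s d ≡ ∏ (λ (i : Fin d) → + (e C suc (toℕ i) ℕ.* s))
binomProd≡∏ e s zero    = refl
binomProd≡∏ e s (suc d) = trans (cong (_* + (e C suc d ℕ.* s)) (binomProd≡∏ e s d))
                                (sym (sum-toℕ-last ℤP.*-1-monoid d (λ a → + (e C suc a ℕ.* s))))

2∑[e∸ks]+d[d+1]s≡2de : ∀ e s d → d ℕ.* s ≤ e →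
  2 ℕ.* ∑ (λ (i : Fin d) → e ∸ suc (toℕ i) ℕ.* s) ℕ.+ d ℕ.* suc d ℕ.* s ≡ 2 ℕ.* (d ℕ.* e)
2∑[e∸ks]+d[d+1]s≡2de e s zero    _ = refl
2∑[e∸ks]+d[d+1]s≡2de e s (suc d) [d+1]s≤e = begin
  2 ℕ.* ∑ {suc d} (h ∘ toℕ) ℕ.+ suc d ℕ.* suc (suc d) ℕ.* s
    ≡⟨ cong (λ S → 2 ℕ.* S ℕ.+ suc d ℕ.* suc (suc d) ℕ.* s) (sum-toℕ-last ℕP.+-0-monoid d h) ⟩
  2 ℕ.* (∑ {d} (h ∘ toℕ) ℕ.+ h d) ℕ.+ suc d ℕ.* suc (suc d) ℕ.* s
    ≡⟨ regroup (∑ {d} (h ∘ toℕ)) (h d) d s ⟩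
  (2 ℕ.* ∑ {d} (h ∘ toℕ) ℕ.+ d ℕ.* suc d ℕ.* s) ℕ.+ 2 ℕ.* (h d ℕ.+ suc d ℕ.* s)
    ≡⟨ cong₂ (λ x y → x ℕ.+ 2 ℕ.* y) (2∑[e∸ks]+d[d+1]s≡2de e s d (ℕP.m+n≤o⇒n≤o s [d+1]s≤e))
                                     (ℕP.m∸n+n≡m [d+1]s≤e) ⟩
  2 ℕ.* (d ℕ.* e) ℕ.+ 2 ℕ.* e
    ≡⟨ collect d e ⟩
  2 ℕ.* (suc d ℕ.* e) ∎
  where
  open ≡-Reasoning
  h : ℕ → ℕ
  h a = e ∸ suc a ℕ.* s
  regroup : ∀ S x d s → 2 ℕ.* (S ℕ.+ x) ℕ.+ suc d ℕ.* suc (suc d) ℕ.* s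
                        ≡ (2 ℕ.* S ℕ.+ d ℕ.* suc d ℕ.* s) ℕ.+ 2 ℕ.* (x ℕ.+ suc d ℕ.* s)
  regroup = ℕ-Solver.solve-∀
  collect : ∀ d e → 2 ℕ.* (d ℕ.* e) ℕ.+ 2 ℕ.* e ≡ 2 ℕ.* (suc d ℕ.* e)
  collect = ℕ-Solver.solve-∀

sumFin-cong : ∀ n {f g : Fin n → ℤ} → (∀ i → f i ≡ g i) → sumFin n f ≡ sumFin n g
sumFin-cong zero    f≡g = refl
sumFin-cong (suc n) f≡g = cong₂ _+_ (f≡g Fin.zero) (sumFin-cong n (f≡g ∘ Fin.suc))

sumFin-zero : ∀ n (f : Fin n → ℤ) → (∀ j → f j ≡ + 0) → sumFin n f ≡ + 0
sumFin-zero zero    f f≡0 = refl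
sumFin-zero (suc n) f f≡0 = cong₂ _+_ (f≡0 Fin.zero) (sumFin-zero n (f ∘ Fin.suc) (f≡0 ∘ Fin.suc))

sumFin-single : ∀ n (f : Fin n → ℤ) i → (∀ j → j ≢ i → f j ≡ + 0) → sumFin n f ≡ f i
sumFin-single (suc n) f Fin.zero f≡0 =
  trans (cong (_+_ (f Fin.zero)) (sumFin-zero n (f ∘ Fin.suc) (λ j → f≡0 (Fin.suc j) λ ())))
        (ℤP.+-identityʳ _)
sumFin-single (suc n) f (Fin.suc i) f≡0 =
  trans (cong (_+ sumFin n (f ∘ Fin.suc)) (f≡0 Fin.zero λ ()))
        (trans (ℤP.+-identityˡ _)
               (sumFin-single n (f ∘ Fin.suc) i (λ j j≢i → f≡0 (Fin.suc j) (j≢i ∘ FinP.suc-injective))))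

det-cong : ∀ n {A B : Fin n → Fin n → ℤ} → (∀ i j → A i j ≡ B i j) → det n A ≡ det n B
det-cong zero    A≡B = refl
det-cong (suc n) A≡B = sumFin-cong (suc n) λ j →
  cong₂ (λ a D → sign (toℕ j) * a * D) (A≡B Fin.zero j)
        (det-cong n λ k l → A≡B (Fin.suc k) (punchIn j l))

punchIn-fromℕ : ∀ n (j : Fin n) → punchIn (fromℕ n) j ≡ inject₁ j
punchIn-fromℕ (suc n) Fin.zero    = refl
punchIn-fromℕ (suc n) (Fin.suc j) = cong Fin.suc (punchIn-fromℕ n j)

1+i+opposite[i]≡n : ∀ {n} (i : Fin n) → suc (toℕ i ℕ.+ toℕ (opposite i)) ≡ n
1+i+opposite[i]≡n i =
  trans (cong (λ b → suc (toℕ i ℕ.+ b)) (FinP.opposite-prop i)) (ℕP.m+[n∸m]≡n (FinP.toℕ<n i))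

1+i+j≡n⇒j≡opposite[i] : ∀ {n} (i j : Fin n) → suc (toℕ i ℕ.+ toℕ j) ≡ n → j ≡ opposite i
1+i+j≡n⇒j≡opposite[i] {n} i j 1+i+j≡n = FinP.toℕ-injective (begin
  toℕ j                               ≡⟨ sym (ℕP.m+n∸m≡n (suc (toℕ i)) (toℕ j)) ⟩
  suc (toℕ i ℕ.+ toℕ j) ∸ suc (toℕ i) ≡⟨ cong (_∸ suc (toℕ i)) 1+i+j≡n ⟩
  n ∸ suc (toℕ i)                     ≡⟨ sym (FinP.opposite-prop i) ⟩
  toℕ (opposite i) ∎)
  where open ≡-Reasoning

det-antidiagonal : ∀ n (A : Fin n → Fin n → ℤ) → (∀ i j → j ≢ opposite i → A i j ≡ + 0) →
  det n A ≡ sign (n C 2) * ∏ (λ i → A i (opposite i))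
det-antidiagonal zero    A off≡0 = refl
det-antidiagonal (suc n) A off≡0 = begin
  det (suc n) A
    ≡⟨ sumFin-single (suc n) _ (fromℕ n) (λ j j≢n → first-row-zero j (off≡0 Fin.zero j j≢n)) ⟩
  sign (toℕ (fromℕ n)) * a * minor (fromℕ n)
    ≡⟨ cong₂ (λ m D → sign m * a * D) (FinP.toℕ-fromℕ n)
             (det-cong n λ k l → cong (A (Fin.suc k)) (punchIn-fromℕ n l)) ⟩
  sign n * a * det n B
    ≡⟨ cong (sign n * a *_) (det-antidiagonal n B off-B≡0) ⟩
  sign n * a * (sign (n C 2) * ∏ (λ i → B i (opposite i)))
    ≡⟨ regroup (sign n) a (sign (n C 2)) _ ⟩
  sign n * sign (n C 2) * (a * ∏ (λ i → B i (opposite i)))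
    ≡⟨ cong (_* (a * ∏ (λ i → B i (opposite i)))) (sym (ℤP.^-distribˡ-+-* (- + 1) n (n C 2))) ⟩
  sign (n ℕ.+ n C 2) * ∏ (λ i → A i (opposite i))
    ≡⟨ cong (λ m → sign m * ∏ (λ i → A i (opposite i))) (sym ([1+n]C2≡n+nC2 n)) ⟩
  sign (suc n C 2) * ∏ (λ i → A i (opposite i)) ∎
  where
  open ≡-Reasoning
  a = A Fin.zero (fromℕ n)
  B : Fin n → Fin n → ℤ
  B k l = A (Fin.suc k) (inject₁ l)
  off-B≡0 : ∀ i j → j ≢ opposite i → B i j ≡ + 0
  off-B≡0 i j j≢i′ = off≡0 (Fin.suc i) (inject₁ j) (j≢i′ ∘ FinP.inject₁-injective)
  minor : Fin (suc n) → ℤ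
  minor j = det n (λ k l → A (Fin.suc k) (punchIn j l))
  first-row-zero : ∀ j {x} → x ≡ + 0 → sign (toℕ j) * x * minor j ≡ + 0
  first-row-zero j refl = trans (cong (_* minor j) (ℤP.*-zeroʳ (sign (toℕ j)))) (ℤP.*-zeroˡ (minor j))
  regroup : ∀ σ a τ P → σ * a * (τ * P) ≡ σ * τ * (a * P)
  regroup = solve-∀

module _ {p r s : ℕ} (e d : ℕ) (p≡1+rs : p ≡ suc (r ℕ.* s)) (0<s : 0 < s) (d≤r : d ≤ r) where

  private
    F : Poly
    F = xPow-1 r ^ₚ e

  M-index : ∀ a b → suc a ℕ.* p ℕ.+ suc b ∸ suc d ≡ suc a ℕ.* s ℕ.* r ℕ.+ suc (a ℕ.+ b) ∸ d
  M-index a b = cong (_∸ suc d) (trans (cong (λ x → suc a ℕ.* x ℕ.+ suc b) p≡1+rs) (expand a b r s))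
    where
    expand : ∀ a b r s → suc a ℕ.* suc (r ℕ.* s) ℕ.+ suc b ≡ suc (suc a ℕ.* s ℕ.* r ℕ.+ suc (a ℕ.+ b))
    expand = ℕ-Solver.solve-∀

  coeff-off-antidiagonal : ∀ a b → a < d → b < d → suc (a ℕ.+ b) ≢ d →
    coeff F (suc a ℕ.* s ℕ.* r ℕ.+ suc (a ℕ.+ b) ∸ d) ≡ + 0
  coeff-off-antidiagonal a b a<d b<d u≢d with ℕP.<-cmp (suc (a ℕ.+ b)) d
  ... | tri< u<d _ _ = trans (cong (coeff F) below)
    (coeff-xPow-1^[q*r∸t]≡0 e K 0<K (ℕP.m<n⇒0<n∸m u<d)
      (ℕP.<-≤-trans (ℕP.∸-monoʳ-< (s≤s z≤n) (ℕP.<⇒≤ u<d)) d≤r))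
    where
    open ≡-Reasoning
    K = suc a ℕ.* s
    u = suc (a ℕ.+ b)
    0<K : 0 < K
    0<K = ℕP.<-≤-trans 0<s (ℕP.m≤n*m s (suc a))
    below : K ℕ.* r ℕ.+ u ∸ d ≡ K ℕ.* r ∸ (d ∸ u)
    below = begin
      K ℕ.* r ℕ.+ u ∸ d               ≡⟨ cong (K ℕ.* r ℕ.+ u ∸_) (sym (ℕP.m+[n∸m]≡n (ℕP.<⇒≤ u<d))) ⟩
      K ℕ.* r ℕ.+ u ∸ (u ℕ.+ (d ∸ u)) ≡⟨ sym (ℕP.∸-+-assoc (K ℕ.* r ℕ.+ u) u (d ∸ u)) ⟩
      K ℕ.* r ℕ.+ u ∸ u ∸ (d ∸ u)     ≡⟨ cong (_∸ (d ∸ u)) (ℕP.m+n∸n≡m (K ℕ.* r) u) ⟩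
      K ℕ.* r ∸ (d ∸ u) ∎
  ... | tri≈ _ u≡d _ = ⊥-elim (u≢d u≡d)
  ... | tri> _ _ d<u = trans (cong (coeff F) (ℕP.+-∸-assoc (suc a ℕ.* s ℕ.* r) (ℕP.<⇒≤ d<u)))
    (coeff-xPow-1^[q*r+t]≡0 e (suc a ℕ.* s) (ℕP.m<n⇒0<n∸m d<u) (ℕP.<-≤-trans u∸d<d d≤r))
    where
    u = suc (a ℕ.+ b)
    u<d+d : u < d ℕ.+ d
    u<d+d = ℕP.≤-<-trans (ℕP.+-monoˡ-≤ b a<d) (ℕP.+-monoʳ-< d b<d)
    u∸d<d : u ∸ d < d
    u∸d<d = subst (u ∸ d <_) (ℕP.m+n∸n≡m d d) (ℕP.∸-monoˡ-< u<d+d (ℕP.<⇒≤ d<u))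

  M-off-antidiagonal : ∀ (i j : Fin d) → j ≢ opposite i → M p d F i j ≡ + 0
  M-off-antidiagonal i j j≢ī = trans (cong (coeff F) (M-index (toℕ i) (toℕ j)))
    (coeff-off-antidiagonal (toℕ i) (toℕ j) (FinP.toℕ<n i) (FinP.toℕ<n j)
                            (j≢ī ∘ 1+i+j≡n⇒j≡opposite[i] i j))

  M-antidiagonal : ∀ (i : Fin d) →
    M p d F i (opposite i) ≡ sign (e ∸ suc (toℕ i) ℕ.* s) * + (e C suc (toℕ i) ℕ.* s)
  M-antidiagonal i = begin
    coeff F (suc a ℕ.* p ℕ.+ suc (toℕ (opposite i)) ∸ suc d)
      ≡⟨ cong (coeff F) (M-index a (toℕ (opposite i))) ⟩
    coeff F (K ℕ.* r ℕ.+ suc (a ℕ.+ toℕ (opposite i)) ∸ d)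
      ≡⟨ cong (λ u → coeff F (K ℕ.* r ℕ.+ u ∸ d)) (1+i+opposite[i]≡n i) ⟩
    coeff F (K ℕ.* r ℕ.+ d ∸ d)
      ≡⟨ cong (coeff F) (ℕP.m+n∸n≡m (K ℕ.* r) d) ⟩
    coeff F (K ℕ.* r)
      ≡⟨ coeff-xPow-1^[q*r] e K 0<r ⟩
    sign (e ∸ K) * + (e C K) ∎
    where
    open ≡-Reasoning
    a = toℕ i
    K = suc a ℕ.* s
    0<r : 0 < r
    0<r = ℕP.≤-trans (s≤s z≤n) (ℕP.≤-trans (FinP.toℕ<n i) d≤r)

  det-M-xPow-1^ : det d (M p d (xPow-1 r ^ₚ e)) ≡
    sign (d C 2 ℕ.+ ∑ (λ (i : Fin d) → e ∸ suc (toℕ i) ℕ.* s)) * binomProd e s d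
  det-M-xPow-1^ = begin
    det d (M p d F)
      ≡⟨ det-antidiagonal d (M p d F) M-off-antidiagonal ⟩
    sign (d C 2) * ∏ (λ i → M p d F i (opposite i))
      ≡⟨ cong (sign (d C 2) *_) (∏-cong M-antidiagonal) ⟩
    sign (d C 2) * ∏ (λ i → sign (h i) * binom i)
      ≡⟨ cong (sign (d C 2) *_) (∏-distrib-* (sign ∘ h) binom) ⟩
    sign (d C 2) * (∏ (sign ∘ h) * ∏ binom)
      ≡⟨ cong₂ (λ σ B → sign (d C 2) * (σ * B)) (sym (sign-∑ d h)) (sym (binomProd≡∏ e s d)) ⟩
    sign (d C 2) * (sign (∑ h) * binomProd e s d)
      ≡⟨ sym (ℤP.*-assoc (sign (d C 2)) _ _) ⟩
    sign (d C 2) * sign (∑ h) * binomProd e s d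
      ≡⟨ cong (_* binomProd e s d) (sym (ℤP.^-distribˡ-+-* (- + 1) (d C 2) (∑ h))) ⟩
    sign (d C 2 ℕ.+ ∑ h) * binomProd e s d ∎
    where
    open ≡-Reasoning
    h : Fin d → ℕ
    h i = e ∸ suc (toℕ i) ℕ.* s
    binom : Fin d → ℤ
    binom i = + (e C suc (toℕ i) ℕ.* s)

prime∤1 : ∀ {p} → Prime p → ¬ p ∣ 1
prime∤1 {p} p-prime p∣1 = ℕP.<⇒≢ (ℕ.nonTrivial⇒n>1 p {{prime⇒nonTrivial p-prime}}) (sym (∣1⇒≡1 p∣1))

prime∤n! : ∀ {p n} → Prime p → n < p → ¬ p ∣ n !
prime∤n! {n = zero}  p-prime _   = prime∤1 p-prime
prime∤n! {n = suc n} p-prime n<p p∣n! with euclidsLemma (suc n) (n !) p-prime p∣n!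
... | inj₁ p∣1+n = ℕP.<⇒≱ n<p (∣⇒≤ p∣1+n)
... | inj₂ p∣n!′ = prime∤n! p-prime (ℕP.<-trans (ℕP.n<1+n n) n<p) p∣n!′

nCk*k![n∸k]!≡n! : ∀ {n k} → k ≤ n → (n C k) ℕ.* (k ! ℕ.* (n ∸ k) !) ≡ n !
nCk*k![n∸k]!≡n! {n} {k} k≤n = trans (cong (ℕ._* (k ! ℕ.* (n ∸ k) !)) (nCk≡n!/k![n-k]! k≤n))
  (m/n*n≡m {{k ℕP.!* (n ∸ k) !≢0}} (k![n∸k]!∣n! k≤n))

prime∤nCk : ∀ {p n k} → Prime p → k ≤ n → n < p → ¬ p ∣ n C k
prime∤nCk p-prime k≤n n<p p∣nCk =
  prime∤n! p-prime n<p (subst (_ ∣_) (nCk*k![n∸k]!≡n! k≤n) (∣m⇒∣m*n _ p∣nCk))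

prime∤∣binomProd∣ : ∀ {p e s} d → Prime p → e < p → d ℕ.* s ≤ e → ¬ p ∣ ℤ.∣ binomProd e s d ∣
prime∤∣binomProd∣ zero    p-prime _   _        = prime∤1 p-prime
prime∤∣binomProd∣ {p} {e} {s} (suc d) p-prime e<p [d+1]s≤e p∣
  with euclidsLemma ℤ.∣ binomProd e s d ∣ (e C suc d ℕ.* s) p-prime
                    (subst (p ∣_) (ℤP.abs-* (binomProd e s d) (+ (e C suc d ℕ.* s))) p∣)
... | inj₁ p∣B = prime∤∣binomProd∣ d p-prime e<p (ℕP.m+n≤o⇒n≤o s [d+1]s≤e) p∣B
... | inj₂ p∣C = prime∤nCk p-prime [d+1]s≤e e<p p∣C

∣sign*x-0∣≡∣x∣ : ∀ k x → ℤ.∣ sign k * x - + 0 ∣ ≡ ℤ.∣ x ∣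
∣sign*x-0∣≡∣x∣ k x = begin
  ℤ.∣ sign k * x - + 0 ∣          ≡⟨ cong ℤ.∣_∣ (ℤP.+-identityʳ (sign k * x)) ⟩
  ℤ.∣ sign k * x ∣                ≡⟨ ℤP.abs-* (sign k) x ⟩
  ℤ.∣ sign k ∣ ℕ.* ℤ.∣ x ∣        ≡⟨ cong (ℕ._* ℤ.∣ x ∣) (∣sign∣≡1 k) ⟩
  1 ℕ.* ℤ.∣ x ∣                    ≡⟨ ℕP.*-identityˡ ℤ.∣ x ∣ ⟩
  ℤ.∣ x ∣ ∎
  where
  open ≡-Reasoning
  ∣sign∣≡1 : ∀ k → ℤ.∣ sign k ∣ ≡ 1
  ∣sign∣≡1 zero    = refl
  ∣sign∣≡1 (suc k) = trans (ℤP.abs-* (- + 1) (sign k)) (trans (ℕP.+-identityʳ _) (∣sign∣≡1 k))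

≡⇒≡[mod] : ∀ {a b p} → a ≡ b → a ≡ b [mod p ]
≡⇒≡[mod] {b = b} {p} refl = subst (λ x → p ∣ ℤ.∣ x ∣) (sym (ℤP.+-inverseʳ b)) (p ∣0)

module _ {p r e d g s : ℕ} (U : InU p r e d g) (r*s≡p∸1 : r ℕ.* s ≡ p ∸ 1) where
  open InU U

  private
    instance
      r≢0 : ℕ.NonZero r
      r≢0 = ℕ.>-nonZero (ℕP.≤-trans (s≤s z≤n) r≥2)

  InU⇒d*s≤e : d ℕ.* s ≤ e
  InU⇒d*s≤e =
    ℕP.*-cancelˡ-≤ r (subst (_≤ r ℕ.* e) (trans (cong (d ℕ.*_) (sym r*s≡p∸1)) (swap d r s)) lower)
    where
    swap : ∀ d r s → d ℕ.* (r ℕ.* s) ≡ r ℕ.* (d ℕ.* s)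
    swap = ℕ-Solver.solve-∀

  InU⇒e≤r*s : e ≤ r ℕ.* s
  InU⇒e≤r*s = subst (e ≤_) (sym r*s≡p∸1) (ℕP.*-cancelˡ-≤ r upper)

  InU⇒p≡1+r*s : p ≡ suc (r ℕ.* s)
  InU⇒p≡1+r*s = trans (sym (ℕP.m+[n∸m]≡n (ℕP.≤-trans d≥1 d≤p))) (cong suc (sym r*s≡p∸1))

  private
    instance
      s≢0 : ℕ.NonZero s
      s≢0 = ℕP.m*n≢0⇒n≢0 r {{ℕ.>-nonZero (ℕP.≤-trans e≥1 InU⇒e≤r*s)}}

  InU⇒e<p : e < p
  InU⇒e<p = subst (e <_) (sym InU⇒p≡1+r*s) (s≤s InU⇒e≤r*s)

  InU⇒d≤r : d ≤ r
  InU⇒d≤r = ℕP.*-cancelʳ-≤ d r s (ℕP.≤-trans InU⇒d*s≤e InU⇒e≤r*s)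

  InU⇒[r∸1]g/2≡∑ : (r ∸ 1) ℕ.* g / 2 ≡ ∑ (λ (i : Fin d) → e ∸ suc (toℕ i) ℕ.* s)
  InU⇒[r∸1]g/2≡∑ = trans (cong (_/ 2) (trans [r∸1]g≡2Σ (ℕP.*-comm 2 Σ))) (m*n/n≡m Σ 2)
    where
    open ≡-Reasoning
    Σ = ∑ (λ (i : Fin d) → e ∸ suc (toℕ i) ℕ.* s)
    expandˡ : ∀ g r q d s →
      r ℕ.* (q ℕ.* g ℕ.+ d ℕ.* suc d ℕ.* s) ≡ g ℕ.* (r ℕ.* q) ℕ.+ d ℕ.* (d ℕ.+ 1) ℕ.* (r ℕ.* s)
    expandˡ = ℕ-Solver.solve-∀
    expandʳ : ∀ r e d → 2 ℕ.* (r ℕ.* e ℕ.* d) ≡ r ℕ.* (2 ℕ.* (d ℕ.* e))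
    expandʳ = ℕ-Solver.solve-∀
    [r∸1]g+d[d+1]s≡2de : (r ∸ 1) ℕ.* g ℕ.+ d ℕ.* suc d ℕ.* s ≡ 2 ℕ.* (d ℕ.* e)
    [r∸1]g+d[d+1]s≡2de = ℕP.*-cancelˡ-≡ _ _ r (begin
      r ℕ.* ((r ∸ 1) ℕ.* g ℕ.+ d ℕ.* suc d ℕ.* s)                ≡⟨ expandˡ g r (r ∸ 1) d s ⟩
      g ℕ.* (r ℕ.* (r ∸ 1)) ℕ.+ d ℕ.* (d ℕ.+ 1) ℕ.* (r ℕ.* s)
        ≡⟨ cong (λ x → g ℕ.* (r ℕ.* (r ∸ 1)) ℕ.+ d ℕ.* (d ℕ.+ 1) ℕ.* x) r*s≡p∸1 ⟩
      g ℕ.* (r ℕ.* (r ∸ 1)) ℕ.+ d ℕ.* (d ℕ.+ 1) ℕ.* (p ∸ 1)      ≡⟨ g-def ⟩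
      2 ℕ.* (r ℕ.* e ℕ.* d)                                      ≡⟨ expandʳ r e d ⟩
      r ℕ.* (2 ℕ.* (d ℕ.* e)) ∎)
    [r∸1]g≡2Σ : (r ∸ 1) ℕ.* g ≡ 2 ℕ.* Σ
    [r∸1]g≡2Σ = ℕP.+-cancelʳ-≡ _ _ _
      (trans [r∸1]g+d[d+1]s≡2de (sym (2∑[e∸ks]+d[d+1]s≡2de e s d InU⇒d*s≤e)))

  InU⇒det≡ : det d (M p d (xPow-1 r ^ₚ e)) ≡
    sign (d ℕ.* (d ∸ 1) / 2 ℕ.+ (r ∸ 1) ℕ.* g / 2) * binomProd e s d
  InU⇒det≡ = trans (det-M-xPow-1^ e d InU⇒p≡1+r*s (ℕ.>-nonZero⁻¹ s) InU⇒d≤r)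
    (cong (λ k → sign k * binomProd e s d) (cong₂ ℕ._+_ (nC2≡n[n∸1]/2 d) (sym InU⇒[r∸1]g/2≡∑)))

lemma7 : (p r e d g s : ℕ) → Prime p → InU p r e d g → r ℕ.* s ≡ p ℕ.∸ 1 →
    (det d (M p d ((xPow r +ₚ constP (- + 1)) ^ₚ e))
      ≡ sign (d ℕ.* (d ℕ.∸ 1) ℕ./ 2 ℕ.+ (r ℕ.∸ 1) ℕ.* g ℕ./ 2) * binomProd e s d [mod p ])
    × ¬ (det d (M p d ((xPow r +ₚ constP (- + 1)) ^ₚ e)) ≡ + 0 [mod p ])
lemma7 p r e d g s p-prime U r*s≡p∸1 = ≡⇒≡[mod] det≡ , det≢0
  where
  k : ℕ
  k = d ℕ.* (d ∸ 1) / 2 ℕ.+ (r ∸ 1) ℕ.* g / 2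
  det≡ : det d (M p d (xPow-1 r ^ₚ e)) ≡ sign k * binomProd e s d
  det≡ = InU⇒det≡ U r*s≡p∸1
  det≢0 : ¬ (det d (M p d (xPow-1 r ^ₚ e)) ≡ + 0 [mod p ])
  det≢0 = prime∤∣binomProd∣ d p-prime (InU⇒e<p U r*s≡p∸1) (InU⇒d*s≤e U r*s≡p∸1)
        ∘ subst (p ∣_) (∣sign*x-0∣≡∣x∣ k (binomProd e s d))
        ∘ subst (λ x → x ≡ + 0 [mod p ]) det≡
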